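{- Let $P$ be a finite set of atomic propositions, $T\in\mathbb{N}$, $\mathbb{T}=\{0,\dots,T\}$, $x:\mathbb{T}\to 2^P$ a discrete-time signal, and $\varphi$ an MTL formula in positive normal form (with closed intervals $[a,b]$, $a,b\in\mathbb{N}$, $a\le b$). Then for every $i\in\mathbb{T}$: $(x,i)\models\varphi \iff \llbracket x,\varphi\rrbracket[i]>0$, and $(x,i)\not\models\varphi\iff\llbracket x,\varphi\rrbracket[i]=0$.
   Context: $x_p[i]=1$ if $p\in x[i]$, else $0$. Positive normal form formulas: $\varphi::=p\mid\neg p\mid\varphi\vee\psi\mid\varphi\wedge\psi\mid F_I\varphi\mid G_I\varphi\mid P_I\varphi\mid H_I\varphi\mid\varphi U_I\psi\mid\varphi S_I\psi$. Classical semantics $\models$: $(x,i)\models p$ iff $x_p[i]=1$; $\neg p,\vee,\wedge$ as usual; $F_I\varphi$: $\exists j\in(i+I)\cap\mathbb{T}$ with $(x,j)\models\varphi$; $G_I\varphi$: $\forall j\in(i+I)\cap\mathbb{T}$; $P_I\varphi$: $\exists j\in(i-I)\cap\mathbb{T}$; $H_I\varphi$: $\forall j\in(i-I)\cap\mathbb{T}$; $\varphi U_I\psi$: $\exists j\in(i+I)\cap\mathbb{T}$ with $(x,j)\models\psi$ and $(x,k)\models\varphi$ for all integers $i<k<j$; $\varphi S_I\psi$: $\exists j\in(i-I)\cap\mathbb{T}$ with $(x,j)\models\psi$ and $(x,k)\models\varphi$ for all integers $j<k<i$. Quantitative semantics (real values): for a closed integer interval $I$ with $|I|$ its number of integer points,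 $\delta$ the Kronecker delta, $w^+_I[t]=\frac{1}{|I|}\sum_{k\in I}\delta(t+k)$, $w^-_I[t]=\frac1{|I|}\sum_{k\in I}\delta(t-k)$. Then $\llbracket x,p\rrbracket[i]=x_p[i]$; $\llbracket x,\neg p\rrbracket[i]=1-x_p[i]$; $\llbracket x,\varphi\vee\psi\rrbracket=\max$, $\llbracket x,\varphi\wedge\psi\rrbracket=\min$ (pointwise); $\llbracket x,F_I\varphi\rrbracket[i]=\sum_{j\in\mathbb{T}}\llbracket x,\varphi\rrbracket[j]\,w^+_I[i-j]$; $\llbracket x,P_I\varphi\rrbracket[i]=\sum_{j\in\mathbb{T}}\llbracket x,\varphi\rrbracket[j]\,w^-_I[i-j]$; $\llbracket x,G_I\varphi\rrbracket[i]=\min_{j\in(i+I)\cap\mathbb{T}}\llbracket x,\varphi\rrbracket[j]$; $\llbracket x,H_I\varphi\rrbracket[i]=\min_{j\in(i-I)\cap\mathbb{T}}\llbracket x,\varphi\rrbracket[j]$ (minimum over the empty set is $1$); $\llbracket x,\varphi U_I\psi\rrbracket[i]=\frac1{|I|}\sum_{j\in I}\llbracket x,G_{[1,j-1]}\varphi\rrbracket[i]\cdot\llbracket x,F_{[j,j]}\psi\rrbracket[i]$; $\llbracket x,\varphi S_I\psi\rrbracket[i]=\frac1{|I|}\sum_{j\in I}\llbracket x,H_{[1,j-1]}\varphi\rrbracket[i]\cdot\llbracket x,P_{[j,j]}\psi\rrbracket[i]$, where $[1,j-1]$ is empty when $j\le 1$. -}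

module Defs where

open import Data.Nat as ℕ using (ℕ; zero; suc; _∸_)
open import Data.Bool using (Bool; true; false; if_then_else_)
open import Data.Fin using (Fin; toℕ)
open import Data.List using (List; map; foldr; allFin; upTo)
open import Data.Integer as ℤ using (ℤ; +_)
open import Data.Product using (Σ; _×_; ∃)
open import Data.Sum using (_⊎_)
open import Relation.Nullary using (¬_; does)
open import Data.Rational as ℚ using (ℚ; 0ℚ; 1ℚ; _⊔_; _⊓_)

record Interval : Set where
  constructor [_,_]⟨_⟩
  field
    lo  : ℕ
    hi  : ℕ
    lo≤hi : lo ℕ.≤ hi
open Interval public

card : Interval → ℕ
card I = suc (hi I ∸ lo I)

-- the integer points of [a,b] (as a list a, a+1, ..., b); empty if b < a
range : ℕ → ℕ → List ℕ
range a b = map (a ℕ.+_) (upTo (suc b ∸ a))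

data Formula (P : Set) : Set where
  atom  : P → Formula P
  natom : P → Formula P
  _∨_   : Formula P → Formula P → Formula P
  _∧_   : Formula P → Formula P → Formula P
  F     : Interval → Formula P → Formula P
  G     : Interval → Formula P → Formula P
  Pa    : Interval → Formula P → Formula P
  H     : Interval → Formula P → Formula P
  _U⟨_⟩_ : Formula P → Interval → Formula P → Formula P
  _S⟨_⟩_ : Formula P → Interval → Formula P → Formula P

-- Discrete-time signals x : 𝕋 → 2^P, with 𝕋 = {0,…,T} ≅ Fin (suc T),
-- and P = Fin m a finite set of atomic propositions.
-- x i p = true  iff  p ∈ x[i].

Signal : ℕ → ℕ → Set
Signal m T = Fin (suc T) → Fin m → Bool

module _ {m T : ℕ} (x : Signal m T) where

  infix 4 _⊨_
  _⊨_ : Fin (suc T) → Formula (Fin m) → Set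
  i ⊨ atom p  = x i p ≡ᵇ true
    where open import Relation.Binary.PropositionalEquality renaming (_≡_ to _≡ᵇ_)
  i ⊨ natom p = x i p ≡ᵇ false
    where open import Relation.Binary.PropositionalEquality renaming (_≡_ to _≡ᵇ_)
  i ⊨ (φ ∨ ψ) = (i ⊨ φ) ⊎ (i ⊨ ψ)
  i ⊨ (φ ∧ ψ) = (i ⊨ φ) × (i ⊨ ψ)
  i ⊨ F I φ = Σ (Fin (suc T)) λ j →
    (toℕ i ℕ.+ lo I ℕ.≤ toℕ j) × (toℕ j ℕ.≤ toℕ i ℕ.+ hi I) × (j ⊨ φ)
  i ⊨ G I φ = (j : Fin (suc T)) →
    toℕ i ℕ.+ lo I ℕ.≤ toℕ j → toℕ j ℕ.≤ toℕ i ℕ.+ hi I → j ⊨ φ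
  i ⊨ Pa I φ = Σ (Fin (suc T)) λ j →
    (toℕ j ℕ.+ lo I ℕ.≤ toℕ i) × (toℕ i ℕ.≤ toℕ j ℕ.+ hi I) × (j ⊨ φ)
  i ⊨ H I φ = (j : Fin (suc T)) →
    toℕ j ℕ.+ lo I ℕ.≤ toℕ i → toℕ i ℕ.≤ toℕ j ℕ.+ hi I → j ⊨ φ
  i ⊨ (φ U⟨ I ⟩ ψ) = Σ (Fin (suc T)) λ j →
    (toℕ i ℕ.+ lo I ℕ.≤ toℕ j) × (toℕ j ℕ.≤ toℕ i ℕ.+ hi I) × (j ⊨ ψ) ×
    ((k : Fin (suc T)) → toℕ i ℕ.< toℕ k → toℕ k ℕ.< toℕ j → k ⊨ φ)
  i ⊨ (φ S⟨ I ⟩ ψ) = Σ (Fin (suc T)) λ j →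
    (toℕ j ℕ.+ lo I ℕ.≤ toℕ i) × (toℕ i ℕ.≤ toℕ j ℕ.+ hi I) × (j ⊨ ψ) ×
    ((k : Fin (suc T)) → toℕ j ℕ.< toℕ k → toℕ k ℕ.< toℕ i → k ⊨ φ)

-- Quantitative semantics (values are rational; all operations used —
-- max, min, finite sums, products, division by |I| — stay in ℚ)

-- finite sum and minimum (min over the empty set is 1)
Σℚ : {A : Set} → List A → (A → ℚ) → ℚ
Σℚ xs f = foldr (λ a r → f a ℚ.+ r) 0ℚ xs

Minℚ : {A : Set} → List A → (A → ℚ) → ℚ
Minℚ xs f = foldr (λ a r → f a ⊓ r) 1ℚ xs

δ : ℤ → ℚ
δ t = if does (t ℤ.≟ + 0) then 1ℚ else 0ℚ

inv : (n : ℕ) → .{{ℕ.NonZero n}} → ℚ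
inv n = + 1 ℚ./ n

w⁺ : Interval → ℤ → ℚ
w⁺ I t = inv (card I) ℚ.* Σℚ (range (lo I) (hi I)) (λ k → δ (t ℤ.+ + k))

w⁻ : Interval → ℤ → ℚ
w⁻ I t = inv (card I) ℚ.* Σℚ (range (lo I) (hi I)) (λ k → δ (t ℤ.- + k))

pt : ℕ → Interval
pt j = [ j , j ]⟨ ℕ.≤-refl ⟩
  where import Data.Nat.Properties as ℕ

bit : Bool → ℚ
bit true  = 1ℚ
bit false = 0ℚ

module _ {m T : ℕ} (x : Signal m T) where

  𝕋 : List (Fin (suc T))
  𝕋 = allFin (suc T)

  Δ : Fin (suc T) → Fin (suc T) → ℤ
  Δ i j = + toℕ i ℤ.- + toℕ j

  Fq : Interval → (Fin (suc T) → ℚ) → Fin (suc T) → ℚ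
  Fq I v i = Σℚ 𝕋 (λ j → v j ℚ.* w⁺ I (Δ i j))

  Pq : Interval → (Fin (suc T) → ℚ) → Fin (suc T) → ℚ
  Pq I v i = Σℚ 𝕋 (λ j → v j ℚ.* w⁻ I (Δ i j))

  -- G_{[a,b]}, H_{[a,b]} : minimum over j ∈ (i ± [a,b]) ∩ 𝕋 ([a,b] may be empty)
  Gq : ℕ → ℕ → (Fin (suc T) → ℚ) → Fin (suc T) → ℚ
  Gq a b v i = Minℚ 𝕋 (λ j →
    if does (toℕ i ℕ.+ a ℕ.≤? toℕ j) ∧ᵇ does (toℕ j ℕ.≤? toℕ i ℕ.+ b)
    then v j else 1ℚ)
    where open import Data.Bool using () renaming (_∧_ to _∧ᵇ_)

  Hq : ℕ → ℕ → (Fin (suc T) → ℚ) → Fin (suc T) → ℚ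
  Hq a b v i = Minℚ 𝕋 (λ j →
    if does (toℕ j ℕ.+ a ℕ.≤? toℕ i) ∧ᵇ does (toℕ i ℕ.≤? toℕ j ℕ.+ b)
    then v j else 1ℚ)
    where open import Data.Bool using () renaming (_∧_ to _∧ᵇ_)

  ⟦_⟧ : Formula (Fin m) → Fin (suc T) → ℚ
  ⟦ atom p ⟧ i  = bit (x i p)
  ⟦ natom p ⟧ i = 1ℚ ℚ.- bit (x i p)
  ⟦ φ ∨ ψ ⟧ i = ⟦ φ ⟧ i ⊔ ⟦ ψ ⟧ i
  ⟦ φ ∧ ψ ⟧ i = ⟦ φ ⟧ i ⊓ ⟦ ψ ⟧ i
  ⟦ F I φ ⟧ i  = Fq I ⟦ φ ⟧ i
  ⟦ Pa I φ ⟧ i = Pq I ⟦ φ ⟧ i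
  ⟦ G I φ ⟧ i  = Gq (lo I) (hi I) ⟦ φ ⟧ i
  ⟦ H I φ ⟧ i  = Hq (lo I) (hi I) ⟦ φ ⟧ i
  ⟦ φ U⟨ I ⟩ ψ ⟧ i = inv (card I) ℚ.* Σℚ (range (lo I) (hi I)) (λ j →
    Gq 1 (j ∸ 1) ⟦ φ ⟧ i ℚ.* Fq (pt j) ⟦ ψ ⟧ i)
  ⟦ φ S⟨ I ⟩ ψ ⟧ i = inv (card I) ℚ.* Σℚ (range (lo I) (hi I)) (λ j →
    Hq 1 (j ∸ 1) ⟦ φ ⟧ i ℚ.* Pq (pt j) ⟦ ψ ⟧ i)

-- The quantitative connectives mirror the Boolean ones on the sign of nonnegative
-- values: max and sums are positive iff some argument is, min and products iff all
-- are, and the convolution weights w±_I[i - j] are positive exactly for j ∈ i ± I.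
-- Hence, by induction on the formula, ⟦x, φ⟧[i] ≥ 0 and it is positive iff
-- (x, i) ⊨ φ; for U and S the only extra work is to reindex the witness j ∈ I as
-- the time point i ± j. Nonnegativity turns "not positive" into "zero".
module Submission where

open import Defs
open import Data.Nat as ℕ using (ℕ; zero; suc; _∸_; s≤s)
import Data.Nat.Properties as ℕ
open import Data.Integer as ℤ using (ℤ; +_; 0ℤ)
import Data.Integer.Properties as ℤ
open import Data.Integer.Tactic.RingSolver using (solve-∀)
open import Data.Rational as ℚ using (ℚ; 0ℚ; 1ℚ; _⊔_; _⊓_; _≤_; _>_; positive; nonNegative)
import Data.Rational.Properties as ℚ
open import Data.Bool using (true; false; if_then_else_) renaming (_∧_ to _∧ᵇ_)
open import Data.Fin using (Fin; toℕ)
open import Data.List using ([]; _∷_)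
open import Data.List.Membership.Propositional using (_∈_)
open import Data.List.Membership.Propositional.Properties using (∈-map⁺; ∈-map⁻; ∈-upTo⁺; ∈-upTo⁻; ∈-allFin)
open import Data.List.Relation.Unary.Any using (here; there)
open import Data.Product using (∃; _×_; _,_; proj₂)
open import Data.Sum as Sum using (_⊎_; inj₁; inj₂; [_,_]′)
open import Data.Unit using (tt)
open import Data.Empty using (⊥-elim)
open import Function.Base using (id; _∘_; const)
open import Function.Bundles using (_⇔_; mk⇔; Equivalence)
open import Relation.Nullary using (¬_; Dec; yes; no; does)
open import Relation.Binary.PropositionalEquality using (_≡_; refl; sym; trans; cong; subst)

open Equivalence using (to; from)

record Measures (A : Set) (v : ℚ) : Set where
  field
    v≥0     : 0ℚ ≤ v
    A⇔v>0 : A ⇔ (v > 0ℚ)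
open Measures

Measures-resp-⇔ : ∀ {A B v} → Measures A v → A ⇔ B → Measures B v
Measures-resp-⇔ m A⇔B = record
  { v≥0 = v≥0 m
  ; A⇔v>0 = mk⇔ (to (A⇔v>0 m) ∘ from A⇔B) (to A⇔B ∘ from (A⇔v>0 m))
  }

nonNeg⇒>0⊎≡0 : ∀ {v} → 0ℚ ≤ v → v > 0ℚ ⊎ v ≡ 0ℚ
nonNeg⇒>0⊎≡0 {v} v≥0 with 0ℚ ℚ.<? v
... | yes v>0 = inj₁ v>0
... | no  v≯0 = inj₂ (ℚ.≤-antisym (ℚ.≮⇒≥ v≯0) v≥0)

Measures⇒¬⇔≡0 : ∀ {A v} → Measures A v → (¬ A) ⇔ (v ≡ 0ℚ)
Measures⇒¬⇔≡0 {A} {v} m = mk⇔ ¬A⇒v≡0 (λ { refl a → ℚ.<-irrefl refl (to (A⇔v>0 m) a) })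
  where
  ¬A⇒v≡0 : ¬ A → v ≡ 0ℚ
  ¬A⇒v≡0 ¬a = [ ⊥-elim ∘ ¬a ∘ from (A⇔v>0 m) , id ]′ (nonNeg⇒>0⊎≡0 (v≥0 m))

>0-measures : ∀ {A c} → A → c > 0ℚ → Measures A c
>0-measures a c>0 = record { v≥0 = ℚ.<⇒≤ c>0 ; A⇔v>0 = mk⇔ (const c>0) (const a) }

1ℚ-measures : ∀ {A} → A → Measures A 1ℚ
1ℚ-measures a = >0-measures a (ℚ.positive⁻¹ 1ℚ)

0ℚ-measures : ∀ {A} → ¬ A → Measures A 0ℚ
0ℚ-measures ¬a = record { v≥0 = ℚ.≤-refl ; A⇔v>0 = mk⇔ (⊥-elim ∘ ¬a) (λ 0>0 → ⊥-elim (ℚ.<-irrefl refl 0>0)) }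

⊔-measures : ∀ {A B a b} → Measures A a → Measures B b → Measures (A ⊎ B) (a ⊔ b)
⊔-measures {a = a} {b} ma mb = record
  { v≥0 = ℚ.≤-trans (v≥0 ma) (ℚ.p≤p⊔q a b)
  ; A⇔v>0 = mk⇔
      (λ { (inj₁ x) → ℚ.<-≤-trans (to (A⇔v>0 ma) x) (ℚ.p≤p⊔q a b)
         ; (inj₂ y) → ℚ.<-≤-trans (to (A⇔v>0 mb) y) (ℚ.p≤q⊔p a b) })
      (λ a⊔b>0 → Sum.map
         (λ a⊔b≡a → from (A⇔v>0 ma) (subst (_> 0ℚ) a⊔b≡a a⊔b>0))
         (λ a⊔b≡b → from (A⇔v>0 mb) (subst (_> 0ℚ) a⊔b≡b a⊔b>0))
         (ℚ.⊔-sel a b))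
  }

⊓-measures : ∀ {A B a b} → Measures A a → Measures B b → Measures (A × B) (a ⊓ b)
⊓-measures {a = a} {b} ma mb = record
  { v≥0 = ℚ.⊓-glb (v≥0 ma) (v≥0 mb)
  ; A⇔v>0 = mk⇔
      (λ (x , y) → [ (λ a⊓b≡a → subst (_> 0ℚ) (sym a⊓b≡a) (to (A⇔v>0 ma) x))
                   , (λ a⊓b≡b → subst (_> 0ℚ) (sym a⊓b≡b) (to (A⇔v>0 mb) y)) ]′ (ℚ.⊓-sel a b))
      (λ a⊓b>0 → from (A⇔v>0 ma) (ℚ.<-≤-trans a⊓b>0 (ℚ.p⊓q≤p a b))
               , from (A⇔v>0 mb) (ℚ.<-≤-trans a⊓b>0 (ℚ.p⊓q≤q a b)))
  }

*-measures : ∀ {A B a b} → Measures A a → Measures B b → Measures (A × B) (a ℚ.* b)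
*-measures {a = a} {b} ma mb = record
  { v≥0 = ℚ.nonNegative⁻¹ _ {{ℚ.nonNeg*nonNeg⇒nonNeg a {{nonNegative (v≥0 ma)}} b {{nonNegative (v≥0 mb)}}}}
  ; A⇔v>0 = mk⇔
      (λ (x , y) → ℚ.positive⁻¹ _ {{ℚ.pos*pos⇒pos a {{positive (to (A⇔v>0 ma) x)}} b {{positive (to (A⇔v>0 mb) y)}}}})
      (λ ab>0 → let a>0 , b>0 = factors>0 ab>0 in from (A⇔v>0 ma) a>0 , from (A⇔v>0 mb) b>0)
  }
  where
  factors>0 : a ℚ.* b > 0ℚ → a > 0ℚ × b > 0ℚ
  factors>0 ab>0 with nonNeg⇒>0⊎≡0 (v≥0 ma) | nonNeg⇒>0⊎≡0 (v≥0 mb)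
  ... | inj₁ a>0  | inj₁ b>0  = a>0 , b>0
  ... | inj₂ refl | _         = ⊥-elim (ℚ.<-irrefl (sym (ℚ.*-zeroˡ b)) ab>0)
  ... | inj₁ _    | inj₂ refl = ⊥-elim (ℚ.<-irrefl (sym (ℚ.*-zeroʳ a)) ab>0)

+-measures : ∀ {A B a b} → Measures A a → Measures B b → Measures (A ⊎ B) (a ℚ.+ b)
+-measures {a = a} {b} ma mb = record
  { v≥0 = ℚ.nonNegative⁻¹ _ {{ℚ.nonNeg+nonNeg⇒nonNeg a {{nonNegative (v≥0 ma)}} b {{nonNegative (v≥0 mb)}}}}
  ; A⇔v>0 = mk⇔
      (λ { (inj₁ x) → ℚ.positive⁻¹ _ {{ℚ.pos+nonNeg⇒pos a {{positive (to (A⇔v>0 ma) x)}} b {{nonNegative (v≥0 mb)}}}}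
         ; (inj₂ y) → ℚ.positive⁻¹ _ {{ℚ.nonNeg+pos⇒pos a {{nonNegative (v≥0 ma)}} b {{positive (to (A⇔v>0 mb) y)}}}} })
      (λ a+b>0 → Sum.map (from (A⇔v>0 ma)) (from (A⇔v>0 mb)) (summand>0 a+b>0))
  }
  where
  summand>0 : a ℚ.+ b > 0ℚ → a > 0ℚ ⊎ b > 0ℚ
  summand>0 a+b>0 with nonNeg⇒>0⊎≡0 (v≥0 ma)
  ... | inj₁ a>0 = inj₁ a>0
  ... | inj₂ refl = inj₂ (subst (_> 0ℚ) (ℚ.+-identityˡ b) a+b>0)

Σℚ-measures : ∀ {I : Set} {P : I → Set} {f : I → ℚ} → (∀ k → Measures (P k) (f k)) →
              ∀ ks → Measures (∃ λ k → k ∈ ks × P k) (Σℚ ks f)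
Σℚ-measures m [] = 0ℚ-measures (λ ())
Σℚ-measures m (k ∷ ks) = Measures-resp-⇔ (+-measures (m k) (Σℚ-measures m ks))
  (mk⇔ (λ { (inj₁ p) → k , here refl , p ; (inj₂ (l , l∈ks , p)) → l , there l∈ks , p })
       (λ { (_ , here refl , p) → inj₁ p ; (l , there l∈ks , p) → inj₂ (l , l∈ks , p) }))

Minℚ-measures : ∀ {I : Set} {P : I → Set} {f : I → ℚ} → (∀ k → Measures (P k) (f k)) →
                ∀ ks → Measures (∀ k → k ∈ ks → P k) (Minℚ ks f)
Minℚ-measures m [] = 1ℚ-measures (λ _ ())
Minℚ-measures m (k ∷ ks) = Measures-resp-⇔ (⊓-measures (m k) (Minℚ-measures m ks))
  (mk⇔ (λ { (p , ps) _ (here refl) → p ; (p , ps) l (there l∈ks) → ps l l∈ks })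
       (λ ps → ps k (here refl) , λ l l∈ks → ps l (there l∈ks)))

bit-measures : ∀ b → Measures (b ≡ true) (bit b)
bit-measures true  = 1ℚ-measures refl
bit-measures false = 0ℚ-measures (λ ())

1-bit-measures : ∀ b → Measures (b ≡ false) (1ℚ ℚ.- bit b)
1-bit-measures false = 1ℚ-measures refl
1-bit-measures true  = 0ℚ-measures (λ ())

δ-measures : ∀ t → Measures (t ≡ 0ℤ) (δ t)
δ-measures t with t ℤ.≟ 0ℤ
... | yes t≡0 = 1ℚ-measures t≡0
... | no  t≢0 = 0ℚ-measures t≢0

scale-measures : ∀ {A c v} → c > 0ℚ → Measures A v → Measures A (c ℚ.* v)
scale-measures c>0 m = Measures-resp-⇔ (*-measures (>0-measures tt c>0) m) (mk⇔ proj₂ (tt ,_))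

inv>0 : ∀ n .{{_ : ℕ.NonZero n}} → inv n > 0ℚ
inv>0 n = ℚ.positive⁻¹ _ {{ℚ.normalize-pos 1 n}}

m<n∸o⇒o+m<n : ∀ {m} n o → m ℕ.< n ∸ o → o ℕ.+ m ℕ.< n
m<n∸o⇒o+m<n n       zero    m<n   = m<n
m<n∸o⇒o+m<n (suc n) (suc o) m<n∸o = s≤s (m<n∸o⇒o+m<n n o m<n∸o)

∈-range⇔ : ∀ {a b k} → k ∈ range a b ⇔ (a ℕ.≤ k × k ℕ.≤ b)
∈-range⇔ {a} {b} {k} = mk⇔
  (λ k∈ → let d , d∈ , k≡a+d = ∈-map⁻ (a ℕ.+_) k∈ in
     subst (λ k → a ℕ.≤ k × k ℕ.≤ b) (sym k≡a+d)
       (ℕ.m≤m+n a d , ℕ.<⇒≤pred (m<n∸o⇒o+m<n (suc b) a (∈-upTo⁻ d∈))))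
  (λ (a≤k , k≤b) → subst (_∈ range a b) (ℕ.m+[n∸m]≡n a≤k)
     (∈-map⁺ (a ℕ.+_) (∈-upTo⁺ (ℕ.∸-monoˡ-< (s≤s k≤b) a≤k))))

average-measures : ∀ I {P : ℕ → Set} {f : ℕ → ℚ} → (∀ k → Measures (P k) (f k)) →
  Measures (∃ λ k → lo I ℕ.≤ k × k ℕ.≤ hi I × P k) (inv (card I) ℚ.* Σℚ (range (lo I) (hi I)) f)
average-measures I m = scale-measures (inv>0 (card I)) (Measures-resp-⇔ (Σℚ-measures m (range (lo I) (hi I)))
  (mk⇔ (λ (k , k∈ , p) → let lo≤k , k≤hi = to ∈-range⇔ k∈ in k , lo≤k , k≤hi , p)
       (λ (k , lo≤k , k≤hi , p) → k , from ∈-range⇔ (lo≤k , k≤hi) , p)))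

offset⇔ : ∀ {a b lo hi} → (∃ λ d → lo ℕ.≤ d × d ℕ.≤ hi × b ≡ a ℕ.+ d) ⇔ (a ℕ.+ lo ℕ.≤ b × b ℕ.≤ a ℕ.+ hi)
offset⇔ {a} {b} {lo} {hi} = mk⇔
  (λ { (d , lo≤d , d≤hi , refl) → ℕ.+-monoʳ-≤ a lo≤d , ℕ.+-monoʳ-≤ a d≤hi })
  (λ (a+lo≤b , b≤a+hi) →
     let a+[b∸a]≡b = ℕ.m+[n∸m]≡n (ℕ.≤-trans (ℕ.m≤m+n a lo) a+lo≤b) in
     b ∸ a
     , ℕ.+-cancelˡ-≤ a _ _ (subst (a ℕ.+ lo ℕ.≤_) (sym a+[b∸a]≡b) a+lo≤b)
     , ℕ.+-cancelˡ-≤ a _ _ (subst (ℕ._≤ a ℕ.+ hi) (sym a+[b∸a]≡b) b≤a+hi)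
     , sym a+[b∸a]≡b)

+m-+n≡0⇔m≡n : ∀ {m n} → (+ m ℤ.- + n ≡ 0ℤ) ⇔ (m ≡ n)
+m-+n≡0⇔m≡n {m} {n} = mk⇔ (ℤ.+-injective ∘ ℤ.i-j≡0⇒i≡j (+ m) (+ n)) (ℤ.i≡j⇒i-j≡0 ∘ cong +_)

i-j+k≡i+k-j : ∀ (i j k : ℤ) → i ℤ.- j ℤ.+ k ≡ (i ℤ.+ k) ℤ.- j
i-j+k≡i+k-j = solve-∀

i-j-k≡i-[j+k] : ∀ (i j k : ℤ) → i ℤ.- j ℤ.- k ≡ i ℤ.- (j ℤ.+ k)
i-j-k≡i-[j+k] = solve-∀

w⁺-measures : ∀ I a b → Measures (a ℕ.+ lo I ℕ.≤ b × b ℕ.≤ a ℕ.+ hi I) (w⁺ I (+ a ℤ.- + b))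
w⁺-measures I a b = Measures-resp-⇔ (average-measures I (λ k → δ-measures (+ a ℤ.- + b ℤ.+ + k)))
  (mk⇔ (λ (k , lo≤k , k≤hi , t≡0) → to offset⇔ (k , lo≤k , k≤hi , sym (to (shift⇔ k) t≡0)))
       (λ window → let k , lo≤k , k≤hi , b≡a+k = from offset⇔ window in
                   k , lo≤k , k≤hi , from (shift⇔ k) (sym b≡a+k)))
  where
  shift⇔ : ∀ k → (+ a ℤ.- + b ℤ.+ + k ≡ 0ℤ) ⇔ (a ℕ.+ k ≡ b)
  shift⇔ k = subst (λ t → (t ≡ 0ℤ) ⇔ (a ℕ.+ k ≡ b))
    (sym (trans (i-j+k≡i+k-j (+ a) (+ b) (+ k)) (cong (ℤ._- + b) (sym (ℤ.pos-+ a k)))))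
    +m-+n≡0⇔m≡n

w⁻-measures : ∀ I a b → Measures (b ℕ.+ lo I ℕ.≤ a × a ℕ.≤ b ℕ.+ hi I) (w⁻ I (+ a ℤ.- + b))
w⁻-measures I a b = Measures-resp-⇔ (average-measures I (λ k → δ-measures (+ a ℤ.- + b ℤ.- + k)))
  (mk⇔ (λ (k , lo≤k , k≤hi , t≡0) → to offset⇔ (k , lo≤k , k≤hi , to (shift⇔ k) t≡0))
       (λ window → let k , lo≤k , k≤hi , a≡b+k = from offset⇔ window in
                   k , lo≤k , k≤hi , from (shift⇔ k) a≡b+k))
  where
  shift⇔ : ∀ k → (+ a ℤ.- + b ℤ.- + k ≡ 0ℤ) ⇔ (a ≡ b ℕ.+ k)
  shift⇔ k = subst (λ t → (t ≡ 0ℤ) ⇔ (a ≡ b ℕ.+ k))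
    (sym (trans (i-j-k≡i-[j+k] (+ a) (+ b) (+ k)) (cong (λ j → + a ℤ.- j) (sym (ℤ.pos-+ b k)))))
    +m-+n≡0⇔m≡n

guarded-measures : ∀ {P Q A v} (p? : Dec P) (q? : Dec Q) → Measures A v →
                   Measures (P → Q → A) (if does p? ∧ᵇ does q? then v else 1ℚ)
guarded-measures (yes p) (yes q) m = Measures-resp-⇔ m (mk⇔ (λ a _ _ → a) (λ f → f p q))
guarded-measures (yes p) (no ¬q) m = 1ℚ-measures (λ _ q → ⊥-elim (¬q q))
guarded-measures (no ¬p) q?      m = 1ℚ-measures (λ p → ⊥-elim (¬p p))

module _ {m T : ℕ} (x : Signal m T) {P : Fin (suc T) → Set} {v : Fin (suc T) → ℚ}
         (m-v : ∀ j → Measures (P j) (v j)) (i : Fin (suc T)) where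

  Fq-measures : ∀ I → Measures
    (∃ λ j → toℕ i ℕ.+ lo I ℕ.≤ toℕ j × toℕ j ℕ.≤ toℕ i ℕ.+ hi I × P j) (Fq x I v i)
  Fq-measures I = Measures-resp-⇔
    (Σℚ-measures (λ j → *-measures (m-v j) (w⁺-measures I (toℕ i) (toℕ j))) (𝕋 x))
    (mk⇔ (λ (j , _ , p , lo≤ , ≤hi) → j , lo≤ , ≤hi , p) (λ (j , lo≤ , ≤hi , p) → j , ∈-allFin j , p , lo≤ , ≤hi))

  Pq-measures : ∀ I → Measures
    (∃ λ j → toℕ j ℕ.+ lo I ℕ.≤ toℕ i × toℕ i ℕ.≤ toℕ j ℕ.+ hi I × P j) (Pq x I v i)
  Pq-measures I = Measures-resp-⇔
    (Σℚ-measures (λ j → *-measures (m-v j) (w⁻-measures I (toℕ i) (toℕ j))) (𝕋 x))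
    (mk⇔ (λ (j , _ , p , lo≤ , ≤hi) → j , lo≤ , ≤hi , p) (λ (j , lo≤ , ≤hi , p) → j , ∈-allFin j , p , lo≤ , ≤hi))

  Gq-measures : ∀ a b → Measures
    (∀ j → toℕ i ℕ.+ a ℕ.≤ toℕ j → toℕ j ℕ.≤ toℕ i ℕ.+ b → P j) (Gq x a b v i)
  Gq-measures a b = Measures-resp-⇔
    (Minℚ-measures (λ j → guarded-measures (toℕ i ℕ.+ a ℕ.≤? toℕ j) (toℕ j ℕ.≤? toℕ i ℕ.+ b) (m-v j)) (𝕋 x))
    (mk⇔ (λ p j → p j (∈-allFin j)) (λ p j _ → p j))

  Hq-measures : ∀ a b → Measures
    (∀ j → toℕ j ℕ.+ a ℕ.≤ toℕ i → toℕ i ℕ.≤ toℕ j ℕ.+ b → P j) (Hq x a b v i)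
  Hq-measures a b = Measures-resp-⇔
    (Minℚ-measures (λ j → guarded-measures (toℕ j ℕ.+ a ℕ.≤? toℕ i) (toℕ i ℕ.≤? toℕ j ℕ.+ b) (m-v j)) (𝕋 x))
    (mk⇔ (λ p j → p j (∈-allFin j)) (λ p j _ → p j))

m+1≤o⇔m<o : ∀ {m o} → (m ℕ.+ 1 ℕ.≤ o) ⇔ (m ℕ.< o)
m+1≤o⇔m<o {m} {o} = mk⇔ (subst (ℕ._≤ o) (ℕ.+-comm m 1)) (subst (ℕ._≤ o) (ℕ.+-comm 1 m))

-- m < o is needed for n = 0, where the truncation 0 ∸ 1 = 0 would admit o = m on the left.
o≤m+[n∸1]⇔o<m+n : ∀ {m n o} → m ℕ.< o → (o ℕ.≤ m ℕ.+ (n ∸ 1)) ⇔ (o ℕ.< m ℕ.+ n)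
o≤m+[n∸1]⇔o<m+n {m} {zero} m<o rewrite ℕ.+-identityʳ m =
  mk⇔ (⊥-elim ∘ ℕ.<⇒≱ m<o) (⊥-elim ∘ ℕ.<⇒≱ m<o ∘ ℕ.<⇒≤)
o≤m+[n∸1]⇔o<m+n {m} {suc n} _ rewrite ℕ.+-suc m n = mk⇔ s≤s ℕ.s≤s⁻¹

module _ {n : ℕ} (i : Fin n) (P Q : Fin n → Set) (I : Interval) where

  until-reindex : (∃ λ j → lo I ℕ.≤ j × j ℕ.≤ hi I ×
                     (∀ l → toℕ i ℕ.+ 1 ℕ.≤ toℕ l → toℕ l ℕ.≤ toℕ i ℕ.+ (j ∸ 1) → P l) ×
                     (∃ λ k → toℕ i ℕ.+ j ℕ.≤ toℕ k × toℕ k ℕ.≤ toℕ i ℕ.+ j × Q k))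
                ⇔ (∃ λ k → toℕ i ℕ.+ lo I ℕ.≤ toℕ k × toℕ k ℕ.≤ toℕ i ℕ.+ hi I × Q k ×
                     (∀ l → toℕ i ℕ.< toℕ l → toℕ l ℕ.< toℕ k → P l))
  until-reindex = mk⇔
    (λ (j , lo≤j , j≤hi , between , k , i+j≤k , k≤i+j , q) →
       let k≡i+j = ℕ.≤-antisym k≤i+j i+j≤k
           i+lo≤k , k≤i+hi = to offset⇔ (j , lo≤j , j≤hi , k≡i+j)
       in k , i+lo≤k , k≤i+hi , q , λ l i<l l<k →
            between l (from m+1≤o⇔m<o i<l) (from (o≤m+[n∸1]⇔o<m+n i<l) (subst (toℕ l ℕ.<_) k≡i+j l<k)))
    (λ (k , i+lo≤k , k≤i+hi , q , between) →
       let j , lo≤j , j≤hi , k≡i+j = from offset⇔ (i+lo≤k , k≤i+hi)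
       in j , lo≤j , j≤hi
          , (λ l i+1≤l l≤i+[j∸1] → let i<l = to m+1≤o⇔m<o i+1≤l in
               between l i<l (subst (toℕ l ℕ.<_) (sym k≡i+j) (to (o≤m+[n∸1]⇔o<m+n i<l) l≤i+[j∸1])))
          , k , ℕ.≤-reflexive (sym k≡i+j) , ℕ.≤-reflexive k≡i+j , q)

  since-reindex : (∃ λ j → lo I ℕ.≤ j × j ℕ.≤ hi I ×
                     (∀ l → toℕ l ℕ.+ 1 ℕ.≤ toℕ i → toℕ i ℕ.≤ toℕ l ℕ.+ (j ∸ 1) → P l) ×
                     (∃ λ k → toℕ k ℕ.+ j ℕ.≤ toℕ i × toℕ i ℕ.≤ toℕ k ℕ.+ j × Q k))
                ⇔ (∃ λ k → toℕ k ℕ.+ lo I ℕ.≤ toℕ i × toℕ i ℕ.≤ toℕ k ℕ.+ hi I × Q k ×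
                     (∀ l → toℕ k ℕ.< toℕ l → toℕ l ℕ.< toℕ i → P l))
  since-reindex = mk⇔
    (λ (j , lo≤j , j≤hi , between , k , k+j≤i , i≤k+j , q) →
       let i≡k+j = ℕ.≤-antisym i≤k+j k+j≤i
           k+lo≤i , i≤k+hi = to offset⇔ (j , lo≤j , j≤hi , i≡k+j)
       in k , k+lo≤i , i≤k+hi , q , λ l k<l l<i →
            between l (from m+1≤o⇔m<o l<i)
              (from (o≤m+[n∸1]⇔o<m+n l<i) (subst (ℕ._< toℕ l ℕ.+ j) (sym i≡k+j) (ℕ.+-monoˡ-< j k<l))))
    (λ (k , k+lo≤i , i≤k+hi , q , between) →
       let j , lo≤j , j≤hi , i≡k+j = from offset⇔ (k+lo≤i , i≤k+hi)
       in j , lo≤j , j≤hi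
          , (λ l l+1≤i i≤l+[j∸1] → let l<i = to m+1≤o⇔m<o l+1≤i in
               between l (ℕ.+-cancelʳ-< j (toℕ k) (toℕ l)
                            (subst (ℕ._< toℕ l ℕ.+ j) i≡k+j (to (o≤m+[n∸1]⇔o<m+n l<i) i≤l+[j∸1]))) l<i)
          , k , ℕ.≤-reflexive (sym i≡k+j) , ℕ.≤-reflexive i≡k+j , q)

module _ {m T : ℕ} (x : Signal m T) where

  ⟦⟧-measures : ∀ φ i → Measures (_⊨_ x i φ) (⟦ x ⟧ φ i)
  ⟦⟧-measures (atom p)  i = bit-measures (x i p)
  ⟦⟧-measures (natom p) i = 1-bit-measures (x i p)
  ⟦⟧-measures (φ ∨ ψ)   i = ⊔-measures (⟦⟧-measures φ i) (⟦⟧-measures ψ i)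
  ⟦⟧-measures (φ ∧ ψ)   i = ⊓-measures (⟦⟧-measures φ i) (⟦⟧-measures ψ i)
  ⟦⟧-measures (F I φ)   i = Fq-measures x (⟦⟧-measures φ) i I
  ⟦⟧-measures (Pa I φ)  i = Pq-measures x (⟦⟧-measures φ) i I
  ⟦⟧-measures (G I φ)   i = Gq-measures x (⟦⟧-measures φ) i (lo I) (hi I)
  ⟦⟧-measures (H I φ)   i = Hq-measures x (⟦⟧-measures φ) i (lo I) (hi I)
  ⟦⟧-measures (φ U⟨ I ⟩ ψ) i = Measures-resp-⇔
    (average-measures I (λ j → *-measures (Gq-measures x (⟦⟧-measures φ) i 1 (j ∸ 1))
                                          (Fq-measures x (⟦⟧-measures ψ) i (pt j))))
    (until-reindex i (λ l → _⊨_ x l φ) (λ l → _⊨_ x l ψ) I)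
  ⟦⟧-measures (φ S⟨ I ⟩ ψ) i = Measures-resp-⇔
    (average-measures I (λ j → *-measures (Hq-measures x (⟦⟧-measures φ) i 1 (j ∸ 1))
                                          (Pq-measures x (⟦⟧-measures ψ) i (pt j))))
    (since-reindex i (λ l → _⊨_ x l φ) (λ l → _⊨_ x l ψ) I)

theorem3 : (m T : ℕ) (x : Signal m T) (φ : Formula (Fin m)) (i : Fin (suc T)) →
    ((_⊨_ x i φ) ⇔ (⟦ x ⟧ φ i > 0ℚ)) × ((¬ _⊨_ x i φ) ⇔ (⟦ x ⟧ φ i ≡ 0ℚ))
theorem3 m T x φ i = A⇔v>0 (⟦⟧-measures x φ i) , Measures⇒¬⇔≡0 (⟦⟧-measures x φ i)
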